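{- Let $M$ be an $\mathcal{O}_L$-module killed by a power of $p$, endowed with an $\mathcal{O}_L$-linear action of $\mathrm{SL}_2(\mathbf{Q}_p)$. Then $M/M^{\mathrm{SL}_2(\mathbf{Q}_p)}$ has no nonzero $\mathrm{SL}_2(\mathbf{Q}_p)$-invariants.
   Context: $L$ is a finite extension of $\mathbf{Q}_p$ with ring of integers $\mathcal{O}_L$. -}

module Defs where

open import Level using (0ℓ) renaming (suc to lsuc)
open import Data.Nat as ℕ using (ℕ; zero; suc; NonZero; _∸_)
open import Data.Nat.Properties using (m^n≢0)
open import Data.Nat.DivMod using (_/_; _mod_)
open import Data.Nat.Primality using (Prime; prime⇒nonZero)
open import Data.Fin using (Fin; toℕ)
import Data.Fin as Fin
open import Data.Product using (Σ; ∃; _×_; _,_; proj₁)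
open import Relation.Binary.PropositionalEquality using (_≡_)
open import Relation.Nullary using (¬_)
open import Algebra.Bundles using (CommutativeRing)
open import Algebra.Structures using (IsAbelianGroup)

module _ (R : CommutativeRing 0ℓ 0ℓ) where
  open CommutativeRing R

  sumR : (n : ℕ) → (Fin n → Carrier) → Carrier
  sumR zero    f = 0#
  sumR (suc n) f = f Fin.zero + sumR n (λ i → f (Fin.suc i))

  powR : Carrier → ℕ → Carrier
  powR x zero    = 1#
  powR x (suc n) = x * powR x n

times : {M : Set} → (M → M → M) → M → ℕ → M → M
times _+_ z zero    m = z
times _+_ z (suc n) m = m + times _+_ z n m

module _ (p : ℕ) (pr : Prime p) where

  private
    instance
      p≢0 : NonZero p
      p≢0 = prime⇒nonZero pr

    pw : ℕ → ℕ
    pw n = p ℕ.^ n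

    digitOf : ℕ → ℕ → Fin p
    digitOf N n = (_/_ N (pw n) {{m^n≢0 p n}}) mod p

  -- p-adic integers ℤ_p, as base-p digit streams  x = Σ_i x_i p^i.
  -- Two streams are equal iff all digits agree.

  ℤp : Set
  ℤp = ℕ → Fin p

  _≈ℤp_ : ℤp → ℤp → Set
  x ≈ℤp y = ∀ n → x n ≡ y n

  trunc : ℤp → ℕ → ℕ
  trunc x zero    = 0
  trunc x (suc k) = trunc x k ℕ.+ toℕ (x k) ℕ.* pw k

  -- the n-th digit of x + y (resp. x * y, -x) only depends on x, y mod p^(n+1)
  _+ℤp_ : ℤp → ℤp → ℤp
  (x +ℤp y) n = digitOf (trunc x (suc n) ℕ.+ trunc y (suc n)) n

  _*ℤp_ : ℤp → ℤp → ℤp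
  (x *ℤp y) n = digitOf (trunc x (suc n) ℕ.* trunc y (suc n)) n

  -ℤp_ : ℤp → ℤp
  (-ℤp x) n = digitOf (pw (suc n) ∸ trunc x (suc n)) n

  ℕ→ℤp : ℕ → ℤp
  ℕ→ℤp N n = digitOf N n

  -- ℚ_p = ℤ_p[1/p] : a pair (x , k) stands for x / p^k.

  ℚp : Set
  ℚp = ℤp × ℕ

  _≈ℚp_ : ℚp → ℚp → Set
  (x , k) ≈ℚp (y , l) = (x *ℤp ℕ→ℤp (pw l)) ≈ℤp (y *ℤp ℕ→ℤp (pw k))

  _+ℚp_ : ℚp → ℚp → ℚp
  (x , k) +ℚp (y , l) = ((x *ℤp ℕ→ℤp (pw l)) +ℤp (y *ℤp ℕ→ℤp (pw k))) , k ℕ.+ l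

  _*ℚp_ : ℚp → ℚp → ℚp
  (x , k) *ℚp (y , l) = (x *ℤp y) , k ℕ.+ l

  -ℚp_ : ℚp → ℚp
  -ℚp (x , k) = (-ℤp x) , k

  _-ℚp_ : ℚp → ℚp → ℚp
  a -ℚp b = a +ℚp (-ℚp b)

  0ℚp 1ℚp : ℚp
  0ℚp = ℕ→ℤp 0 , 0
  1ℚp = ℕ→ℤp 1 , 0

  ℤp→ℚp : ℤp → ℚp
  ℤp→ℚp x = x , 0

  record SL2 : Set where
    constructor mat
    field
      a b c d : ℚp
      det≡1   : ((a *ℚp d) -ℚp (b *ℚp c)) ≈ℚp 1ℚp

  open SL2 public

  _≈SL2_ : SL2 → SL2 → Set
  g ≈SL2 h = (a g ≈ℚp a h) × (b g ≈ℚp b h) × (c g ≈ℚp c h) × (d g ≈ℚp d h)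

  IsIdentity : SL2 → Set
  IsIdentity g = (a g ≈ℚp 1ℚp) × (b g ≈ℚp 0ℚp) × (c g ≈ℚp 0ℚp) × (d g ≈ℚp 1ℚp)

  IsProduct : SL2 → SL2 → SL2 → Set
  IsProduct g h k =
      (a k ≈ℚp ((a g *ℚp a h) +ℚp (b g *ℚp c h)))
    × (b k ≈ℚp ((a g *ℚp b h) +ℚp (b g *ℚp d h)))
    × (c k ≈ℚp ((c g *ℚp a h) +ℚp (d g *ℚp c h)))
    × (d k ≈ℚp ((c g *ℚp b h) +ℚp (d g *ℚp d h)))

  record FiniteExtension : Set₁ where
    field
      fieldRing : CommutativeRing 0ℓ 0ℓ
    open CommutativeRing fieldRing public
    field
      1≉0     : ¬ (1# ≈ 0#)
      inverse : ∀ x → ¬ (x ≈ 0#) → ∃ λ y → (x * y) ≈ 1#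
      ι       : ℚp → Carrier
      ι-cong  : ∀ {x y} → x ≈ℚp y → ι x ≈ ι y
      ι-+     : ∀ x y → ι (x +ℚp y) ≈ (ι x + ι y)
      ι-*     : ∀ x y → ι (x *ℚp y) ≈ (ι x * ι y)
      ι-1     : ι 1ℚp ≈ 1#
      dim     : ℕ
      basis   : Fin dim → Carrier
      spans   : ∀ x → ∃ λ (coeff : Fin dim → ℚp) →
                  x ≈ sumR fieldRing dim (λ i → ι (coeff i) * basis i)

    sumL = sumR fieldRing
    powL = powR fieldRing

    IsIntegral : Carrier → Set
    IsIntegral x = ∃ λ (n : ℕ) → ∃ λ (coeff : Fin n → ℤp) →
      (powL x n + sumL n (λ i → ι (ℤp→ℚp (coeff i)) * powL x (toℕ i))) ≈ 0#

    𝒪L : Set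
    𝒪L = Σ Carrier IsIntegral

  record TorsionSL2Rep (L : FiniteExtension) : Set₁ where
    private module L = FiniteExtension L
    infixl 6 _+_
    infixr 7 _·_
    field
      M      : Set
      _≈_    : M → M → Set
      _+_    : M → M → M
      0M     : M
      -_     : M → M
      isAbelianGroup : IsAbelianGroup _≈_ _+_ 0M -_
      _·_        : L.𝒪L → M → M
      ·-cong     : ∀ {α β : L.𝒪L} {m n} → proj₁ α L.≈ proj₁ β → m ≈ n → (α · m) ≈ (β · n)
      ·-distribˡ : ∀ (α : L.𝒪L) m n → (α · (m + n)) ≈ ((α · m) + (α · n))
      ·-distribʳ : ∀ (α β γ : L.𝒪L) m → proj₁ γ L.≈ (proj₁ α L.+ proj₁ β) →
                     (γ · m) ≈ ((α · m) + (β · m))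
      ·-assoc    : ∀ (α β γ : L.𝒪L) m → proj₁ γ L.≈ (proj₁ α L.* proj₁ β) →
                     (γ · m) ≈ (α · (β · m))
      ·-identity : ∀ (α : L.𝒪L) m → proj₁ α L.≈ L.1# → (α · m) ≈ m
      ρ          : SL2 → M → M
      ρ-cong     : ∀ {g h m n} → g ≈SL2 h → m ≈ n → ρ g m ≈ ρ h n
      ρ-identity : ∀ g m → IsIdentity g → ρ g m ≈ m
      ρ-product  : ∀ g h k m → IsProduct g h k → ρ k m ≈ ρ g (ρ h m)
      ρ-+        : ∀ g m n → ρ g (m + n) ≈ (ρ g m + ρ g n)
      ρ-·        : ∀ g (α : L.𝒪L) m → ρ g (α · m) ≈ (α · ρ g m)

    field
      killedByPowerOfp : ∃ λ (k : ℕ) → ∀ m → (times _+_ 0M (p ℕ.^ k) m) ≈ 0M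

    _-M_ : M → M → M
    m -M n = m + (- n)

    Invariant : M → Set
    Invariant m = ∀ g → ρ g m ≈ m

    ClassInvariantInQuotient : M → Set
    ClassInvariantInQuotient m = ∀ g → Invariant (ρ g m -M m)

    ClassZeroInQuotient : M → Set
    ClassZeroInQuotient m = Invariant m

module Submission where

-- Let v ∈ M be such that its class in M / M^G is invariant, G = SL₂(ℚ_p).
-- Then φ g = g v - v takes values in M^G, and this makes φ a
-- homomorphism G → M:  φ (g h) = g (φ h) + φ g = φ h + φ g.  We show
-- that φ = 0, i.e. v ∈ M^G.

open import Level using (0ℓ)
open import Data.Nat using (ℕ)
open import Data.Nat.Primality using (Prime)
open import Data.Integer using () renaming (+-*-rawRing to ℤ-rawRing)
open import Algebra.Bundles using (CommutativeRing)
open import Algebra.Solver.Ring.AlmostCommutativeRing using (fromCommutativeRing; _-Raw-AlmostCommutative⟶_)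
import Relation.Binary.Reasoning.Setoid as SetoidReasoning
open import Defs using (FiniteExtension; TorsionSL2Rep)

module SpecialLinearGroup (R : CommutativeRing 0ℓ 0ℓ)
                         (ι : ℤ-rawRing -Raw-AlmostCommutative⟶ fromCommutativeRing R) where

  open import Defs using (times)
  open import Data.Nat using (zero; suc)
  open import Data.Integer as Z using (+_)
  open import Data.Product using (Σ; _×_; _,_)
  open import Data.Sum using (_⊎_; inj₁; inj₂)
  open import Data.Maybe using (Maybe; just; nothing)
  open import Relation.Nullary using (yes; no)
  import Relation.Binary.PropositionalEquality as ≡
  open import Algebra.Bundles using (AbelianGroup)
  import Algebra.Solver.Ring as RingSolver
  import Algebra.Properties.Group as GroupProperties

  open CommutativeRing R
  open _-Raw-AlmostCommutative⟶_ ι using (⟦_⟧)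

  private
    coefficient-≟ : ∀ i j → Maybe (⟦ i ⟧ ≈ ⟦ j ⟧)
    coefficient-≟ i j with i Z.≟ j
    ... | yes ≡.refl = just refl
    ... | no _       = nothing

  open RingSolver ℤ-rawRing (fromCommutativeRing R) ι coefficient-≟
    using (Polynomial; solve; _:=_; _:+_; _:*_; _:-_; :-_; con)

  𝟘 𝟙 : Carrier
  𝟘 = ⟦ + 0 ⟧
  𝟙 = ⟦ + 1 ⟧

  record SL : Set where
    constructor mk
    field
      a b c d : Carrier
      det     : a * d - b * c ≈ 𝟙

  open SL public

  infix 4 _≃_
  _≃_ : SL → SL → Set
  g ≃ h = (a g ≈ a h) × (b g ≈ b h) × (c g ≈ c h) × (d g ≈ d h)

  -- Matrices of polynomials, mirroring the entries of SL so that
  -- identities between products of matrices are solver goals.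
  record PMat (n : ℕ) : Set where
    constructor pmat
    field
      pa pb pc pd : Polynomial n

  open PMat

  infixl 7 _⊙_
  _⊙_ : ∀ {n} → PMat n → PMat n → PMat n
  G ⊙ H = pmat (pa G :* pa H :+ pb G :* pc H) (pa G :* pb H :+ pb G :* pd H)
               (pc G :* pa H :+ pd G :* pc H) (pc G :* pb H :+ pd G :* pd H)

  :𝟘 :𝟙 : ∀ {n} → Polynomial n
  :𝟘 = con (+ 0)
  :𝟙 = con (+ 1)

  uₚ lₚ : ∀ {n} → Polynomial n → PMat n
  uₚ x = pmat :𝟙 x :𝟘 :𝟙
  lₚ x = pmat :𝟙 :𝟘 x :𝟙

  infixl 7 _·_
  _·_ : SL → SL → SL
  g · h = mk (a g * a h + b g * c h) (a g * b h + b g * d h) (c g * a h + d g * c h) (c g * b h + d g * d h)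
             (trans (det-product (a g) (b g) (c g) (d g) (a h) (b h) (c h) (d h))
                    (trans (*-cong (det g) (det h)) (solve 0 (:𝟙 :* :𝟙 := :𝟙) refl)))
    where
    det-product = solve 8 (λ a b c d a′ b′ c′ d′ →
      let P = pmat a b c d ⊙ pmat a′ b′ c′ d′ in
      pa P :* pd P :- pb P :* pc P := (a :* d :- b :* c) :* (a′ :* d′ :- b′ :* c′)) refl

  u l : Carrier → SL
  u x = mk 𝟙 x 𝟘 𝟙 (solve 1 (λ x → :𝟙 :* :𝟙 :- x :* :𝟘 := :𝟙) refl x)
  l x = mk 𝟙 𝟘 x 𝟙 (solve 1 (λ x → :𝟙 :* :𝟙 :- :𝟘 :* x := :𝟙) refl x)

  u-cong : ∀ {x y} → x ≈ y → u x ≃ u y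
  u-cong x≈y = refl , x≈y , refl , refl

  l-cong : ∀ {x y} → x ≈ y → l x ≃ l y
  l-cong x≈y = refl , refl , x≈y , refl

  u-+ : ∀ x y → u (x + y) ≃ u x · u y
  u-+ x y = solve 2 (λ x y → :𝟙 := pa (uₚ x ⊙ uₚ y)) refl x y
          , solve 2 (λ x y → x :+ y := pb (uₚ x ⊙ uₚ y)) refl x y
          , solve 2 (λ x y → :𝟘 := pc (uₚ x ⊙ uₚ y)) refl x y
          , solve 2 (λ x y → :𝟙 := pd (uₚ x ⊙ uₚ y)) refl x y

  l-+ : ∀ x y → l (x + y) ≃ l x · l y
  l-+ x y = solve 2 (λ x y → :𝟙 := pa (lₚ x ⊙ lₚ y)) refl x y
          , solve 2 (λ x y → :𝟘 := pb (lₚ x ⊙ lₚ y)) refl x y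
          , solve 2 (λ x y → x :+ y := pc (lₚ x ⊙ lₚ y)) refl x y
          , solve 2 (λ x y → :𝟙 := pd (lₚ x ⊙ lₚ y)) refl x y

  l-cancelˡ : ∀ x g → l (- x) · (l x · g) ≃ g
  l-cancelˡ x (mk a b c d _) =
      solve 5 (λ x a b c d → pa (lₚ (:- x) ⊙ (lₚ x ⊙ pmat a b c d)) := a) refl x a b c d
    , solve 5 (λ x a b c d → pb (lₚ (:- x) ⊙ (lₚ x ⊙ pmat a b c d)) := b) refl x a b c d
    , solve 5 (λ x a b c d → pc (lₚ (:- x) ⊙ (lₚ x ⊙ pmat a b c d)) := c) refl x a b c d
    , solve 5 (λ x a b c d → pd (lₚ (:- x) ⊙ (lₚ x ⊙ pmat a b c d)) := d) refl x a b c d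

  l-cancelʳ : ∀ g x → (g · l x) · l (- x) ≃ g
  l-cancelʳ (mk a b c d _) x =
      solve 5 (λ x a b c d → pa ((pmat a b c d ⊙ lₚ x) ⊙ lₚ (:- x)) := a) refl x a b c d
    , solve 5 (λ x a b c d → pb ((pmat a b c d ⊙ lₚ x) ⊙ lₚ (:- x)) := b) refl x a b c d
    , solve 5 (λ x a b c d → pc ((pmat a b c d ⊙ lₚ x) ⊙ lₚ (:- x)) := c) refl x a b c d
    , solve 5 (λ x a b c d → pd ((pmat a b c d ⊙ lₚ x) ⊙ lₚ (:- x)) := d) refl x a b c d

  -- Using hypotheses X ≈ 𝟙: an equation L ≈ R follows once L - R is a
  -- combination of the X - 𝟙 in the polynomial ring.
  using₁ : ∀ {L R X} k → L ≈ R + k * (X - 𝟙) → X ≈ 𝟙 → L ≈ R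
  using₁ {R = R} k L≈ X≈𝟙 =
    trans L≈ (trans (+-cong refl (*-cong refl (+-cong X≈𝟙 refl)))
                    (solve 2 (λ r k → r :+ k :* (:𝟙 :- :𝟙) := r) refl R k))

  using₂ : ∀ {L R X Y} k m → L ≈ R + k * (X - 𝟙) + m * (Y - 𝟙) → X ≈ 𝟙 → Y ≈ 𝟙 → L ≈ R
  using₂ {R = R} k m L≈ X≈𝟙 Y≈𝟙 =
    trans L≈ (trans (+-cong (+-cong refl (*-cong refl (+-cong X≈𝟙 refl))) (*-cong refl (+-cong Y≈𝟙 refl)))
                    (solve 3 (λ r k m → r :+ k :* (:𝟙 :- :𝟙) :+ m :* (:𝟙 :- :𝟙) := r) refl R k m))

  Unit : Carrier → Set
  Unit x = Σ Carrier λ x′ → x * x′ ≈ 𝟙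

  infixl 7 _⊗_
  data Elementary : SL → Set where
    upper : ∀ x → Elementary (u x)
    lower : ∀ x → Elementary (l x)
    _⊗_   : ∀ {g h} → Elementary g → Elementary h → Elementary (g · h)
    resp  : ∀ {g h} → g ≃ h → Elementary g → Elementary h

  lower-left-unit : ∀ g → Unit (c g) → Elementary g
  lower-left-unit g@(mk a b c d det) (c′ , cc′≈𝟙) = resp decomposition (upper α ⊗ (lower c ⊗ upper β))
    where
    α β : Carrier
    α = (a - 𝟙) * c′
    β = (d - 𝟙) * c′
    M : ∀ {n} (a c d c′ : Polynomial n) → PMat n
    M a c d c′ = uₚ ((a :- :𝟙) :* c′) ⊙ (lₚ c ⊙ uₚ ((d :- :𝟙) :* c′))
    decomposition : u α · (l c · u β) ≃ g
    decomposition =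
        using₁ (a - 𝟙)
          (solve 4 (λ a c d c′ → pa (M a c d c′) := a :+ (a :- :𝟙) :* (c :* c′ :- :𝟙)) refl a c d c′) cc′≈𝟙
      , using₂ (b + (a - 𝟙) * (d - 𝟙) * c′) c′
          (solve 5 (λ a b c d c′ → pb (M a c d c′)
                      := b :+ (b :+ (a :- :𝟙) :* (d :- :𝟙) :* c′) :* (c :* c′ :- :𝟙) :+ c′ :* (a :* d :- b :* c :- :𝟙))
                   refl a b c d c′) cc′≈𝟙 det
      , solve 4 (λ a c d c′ → pc (M a c d c′) := c) refl a c d c′
      , using₁ (d - 𝟙)
          (solve 4 (λ a c d c′ → pd (M a c d c′) := d :+ (d :- :𝟙) :* (c :* c′ :- :𝟙)) refl a c d c′) cc′≈𝟙

  -- If a is a unit, k = l x · g with x = (1 - c)/a has lower-left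
  -- entry 1, and g = l (-x) · k.
  upper-left-unit : ∀ g → Unit (a g) → Elementary g
  upper-left-unit g@(mk a b c d _) (a′ , aa′≈𝟙) =
    resp (l-cancelˡ x g) (lower (- x) ⊗ lower-left-unit (l x · g) (𝟙 , c≈𝟙))
    where
    x = (𝟙 - c) * a′
    c≈𝟙 : SL.c (l x · g) * 𝟙 ≈ 𝟙
    c≈𝟙 = using₁ (𝟙 - c)
      (solve 5 (λ a b c d a′ → pc (lₚ ((:𝟙 :- c) :* a′) ⊙ pmat a b c d) :* :𝟙
                  := :𝟙 :+ (:𝟙 :- c) :* (a :* a′ :- :𝟙)) refl a b c d a′) aa′≈𝟙

  -- If d is a unit, k = g · l x with x = (1 - c)/d has lower-left
  -- entry 1, and g = k · l (-x).
  lower-right-unit : ∀ g → Unit (d g) → Elementary g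
  lower-right-unit g@(mk a b c d _) (d′ , dd′≈𝟙) =
    resp (l-cancelʳ g x) (lower-left-unit (g · l x) (𝟙 , c≈𝟙) ⊗ lower (- x))
    where
    x = (𝟙 - c) * d′
    c≈𝟙 : SL.c (g · l x) * 𝟙 ≈ 𝟙
    c≈𝟙 = using₁ (𝟙 - c)
      (solve 5 (λ a b c d d′ → pc (pmat a b c d ⊙ lₚ ((:𝟙 :- c) :* d′)) :* :𝟙
                  := :𝟙 :+ (:𝟙 :- c) :* (d :* d′ :- :𝟙)) refl a b c d d′) dd′≈𝟙

  -- If b is a unit, k = g · l x with x = (1 - a)/b has upper-left
  -- entry 1, and g = k · l (-x).
  upper-right-unit : ∀ g → Unit (b g) → Elementary g
  upper-right-unit g@(mk a b c d _) (b′ , bb′≈𝟙) =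
    resp (l-cancelʳ g x) (upper-left-unit (g · l x) (𝟙 , a≈𝟙) ⊗ lower (- x))
    where
    x = (𝟙 - a) * b′
    a≈𝟙 : SL.a (g · l x) * 𝟙 ≈ 𝟙
    a≈𝟙 = using₁ (𝟙 - a)
      (solve 5 (λ a b c d b′ → pa (pmat a b c d ⊙ lₚ ((:𝟙 :- a) :* b′)) :* :𝟙
                  := :𝟙 :+ (:𝟙 :- a) :* (b :* b′ :- :𝟙)) refl a b c d b′) bb′≈𝟙

  unit-entry⇒elementary : ∀ g → Unit (a g) ⊎ Unit (b g) ⊎ Unit (c g) ⊎ Unit (d g) → Elementary g
  unit-entry⇒elementary g (inj₁ a-unit)                 = upper-left-unit g a-unit
  unit-entry⇒elementary g (inj₂ (inj₁ b-unit))          = upper-right-unit g b-unit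
  unit-entry⇒elementary g (inj₂ (inj₂ (inj₁ c-unit)))   = lower-left-unit g c-unit
  unit-entry⇒elementary g (inj₂ (inj₂ (inj₂ d-unit)))   = lower-right-unit g d-unit

  module Homomorphism (A : AbelianGroup 0ℓ 0ℓ) (φ : SL → AbelianGroup.Carrier A)
                      (φ-cong : ∀ {g h} → g ≃ h → AbelianGroup._≈_ A (φ g) (φ h))
                      (φ-· : ∀ g h → AbelianGroup._≈_ A (φ (g · h)) (AbelianGroup._∙_ A (φ g) (φ h))) where

    open AbelianGroup A using (_∙_; ε) renaming (_≈_ to _≈ᴬ_)
    private
      module A = AbelianGroup A
      module GP = GroupProperties A.group

    kills-elementary : (∀ x → φ (u x) ≈ᴬ ε) → (∀ x → φ (l x) ≈ᴬ ε) → ∀ {g} → Elementary g → φ g ≈ᴬ ε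
    kills-elementary φu≈ε φl≈ε (upper x)  = φu≈ε x
    kills-elementary φu≈ε φl≈ε (lower x)  = φl≈ε x
    kills-elementary φu≈ε φl≈ε (_⊗_ {g} {h} Eg Eh) =
      A.trans (φ-· g h)
        (A.trans (A.∙-cong (kills-elementary φu≈ε φl≈ε Eg) (kills-elementary φu≈ε φl≈ε Eh)) (A.identityʳ ε))
    kills-elementary φu≈ε φl≈ε (resp g≃h Eg) = A.trans (A.sym (φ-cong g≃h)) (kills-elementary φu≈ε φl≈ε Eg)

    module OneParameter (f : Carrier → SL) (f-cong : ∀ {x y} → x ≈ y → f x ≃ f y)
                        (f-+ : ∀ x y → f (x + y) ≃ f x · f y) where

      φf-additive : ∀ x y → φ (f (x + y)) ≈ᴬ φ (f x) ∙ φ (f y)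
      φf-additive x y = A.trans (φ-cong (f-+ x y)) (φ-· (f x) (f y))

      φf-𝟘 : φ (f 𝟘) ≈ᴬ ε
      φf-𝟘 = GP.identityʳ-unique (φ (f 𝟘)) (φ (f 𝟘))
               (A.sym (A.trans (φ-cong (f-cong 𝟘≈𝟘+𝟘)) (φf-additive 𝟘 𝟘)))
        where
        𝟘≈𝟘+𝟘 : 𝟘 ≈ 𝟘 + 𝟘
        𝟘≈𝟘+𝟘 = solve 0 (:𝟘 := :𝟘 :+ :𝟘) refl

      φf-multiple : ∀ n y → φ (f (times _+_ 𝟘 n y)) ≈ᴬ times _∙_ ε n (φ (f y))
      φf-multiple zero    y = φf-𝟘
      φf-multiple (suc n) y = A.trans (φf-additive y (times _+_ 𝟘 n y)) (A.∙-cong A.refl (φf-multiple n y))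

      kills-divisible : ∀ n → (∀ m → times _∙_ ε n m ≈ᴬ ε) → ∀ x y → x ≈ times _+_ 𝟘 n y → φ (f x) ≈ᴬ ε
      kills-divisible n n·≈ε x y x≈ny = A.trans (φ-cong (f-cong x≈ny)) (A.trans (φf-multiple n y) (n·≈ε _))

-- Congruences of integers, a ≡ b [mod q ], carrying the quotient
-- (a - b) / q explicitly so that all reasoning stays constructive.
module Congruence where

  open import Data.Nat as N using (NonZero; _<_)
  open import Data.Nat.DivMod using (_/_; _%_; m≡m%n+[m/n]*n; [m+kn]%n≡m%n; m<n⇒m%n≡m)
  open import Data.Integer as Z using (ℤ; +_; -[1+_])
  import Data.Integer.Properties as ZP
  open import Data.Integer.Tactic.RingSolver using (solve-∀)
  open import Relation.Binary.PropositionalEquality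

  infix 4 _≡_[mod_]
  infixr 4 _,_
  record _≡_[mod_] (a b : ℤ) (q : ℕ) : Set where
    constructor _,_
    field
      quotient : ℤ
      equation : a Z.- b ≡ quotient Z.* + q

  module _ {q : ℕ} where

    mod-refl : ∀ {a} → a ≡ a [mod q ]
    mod-refl {a} = Z.0ℤ , trans (ZP.+-inverseʳ a) (sym (ZP.*-zeroˡ (+ q)))

    mod-≡ : ∀ {a b} → a ≡ b → a ≡ b [mod q ]
    mod-≡ refl = mod-refl

    mod-combination₁ : ∀ {L R a₁ b₁} c₁ → L Z.- R ≡ c₁ Z.* (a₁ Z.- b₁) →
                       a₁ ≡ b₁ [mod q ] → L ≡ R [mod q ]
    mod-combination₁ c₁ e (t₁ , e₁) =
      c₁ Z.* t₁ , trans e (trans (cong (c₁ Z.*_) e₁) (sym (ZP.*-assoc c₁ t₁ (+ q))))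

    mod-combination₂ : ∀ {L R a₁ b₁ a₂ b₂} c₁ c₂ →
                       L Z.- R ≡ c₁ Z.* (a₁ Z.- b₁) Z.+ c₂ Z.* (a₂ Z.- b₂) →
                       a₁ ≡ b₁ [mod q ] → a₂ ≡ b₂ [mod q ] → L ≡ R [mod q ]
    mod-combination₂ c₁ c₂ e (t₁ , e₁) (t₂ , e₂) =
      c₁ Z.* t₁ Z.+ c₂ Z.* t₂ ,
      trans e (trans (cong₂ (λ u v → c₁ Z.* u Z.+ c₂ Z.* v) e₁ e₂) (factor c₁ t₁ c₂ t₂ (+ q)))
      where
      factor : ∀ c₁ t₁ c₂ t₂ q → c₁ Z.* (t₁ Z.* q) Z.+ c₂ Z.* (t₂ Z.* q) ≡ (c₁ Z.* t₁ Z.+ c₂ Z.* t₂) Z.* q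
      factor = solve-∀

    mod-sym : ∀ {a b} → a ≡ b [mod q ] → b ≡ a [mod q ]
    mod-sym {a} {b} = mod-combination₁ (Z.- + 1) (lemma a b)
      where
      lemma : ∀ a b → b Z.- a ≡ Z.- + 1 Z.* (a Z.- b)
      lemma = solve-∀

    mod-trans : ∀ {a b c} → a ≡ b [mod q ] → b ≡ c [mod q ] → a ≡ c [mod q ]
    mod-trans {a} {b} {c} = mod-combination₂ (+ 1) (+ 1) (lemma a b c)
      where
      lemma : ∀ a b c → a Z.- c ≡ + 1 Z.* (a Z.- b) Z.+ + 1 Z.* (b Z.- c)
      lemma = solve-∀

    mod-+ : ∀ {a b c d} → a ≡ b [mod q ] → c ≡ d [mod q ] → a Z.+ c ≡ b Z.+ d [mod q ]
    mod-+ {a} {b} {c} {d} = mod-combination₂ (+ 1) (+ 1) (lemma a b c d)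
      where
      lemma : ∀ a b c d → (a Z.+ c) Z.- (b Z.+ d) ≡ + 1 Z.* (a Z.- b) Z.+ + 1 Z.* (c Z.- d)
      lemma = solve-∀

    mod-* : ∀ {a b c d} → a ≡ b [mod q ] → c ≡ d [mod q ] → a Z.* c ≡ b Z.* d [mod q ]
    mod-* {a} {b} {c} {d} = mod-combination₂ c b (lemma a b c d)
      where
      lemma : ∀ a b c d → a Z.* c Z.- b Z.* d ≡ c Z.* (a Z.- b) Z.+ b Z.* (c Z.- d)
      lemma = solve-∀

    mod-neg : ∀ {a b} → a ≡ b [mod q ] → Z.- a ≡ Z.- b [mod q ]
    mod-neg {a} {b} = mod-combination₁ (Z.- + 1) (lemma a b)
      where
      lemma : ∀ a b → Z.- a Z.- Z.- b ≡ Z.- + 1 Z.* (a Z.- b)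
      lemma = solve-∀

    mod-multiple : ∀ t → t Z.* + q ≡ Z.0ℤ [mod q ]
    mod-multiple t = t , ZP.+-identityʳ _

  mod-divisor : ∀ {q} r {a b} → a ≡ b [mod r N.* q ] → a ≡ b [mod q ]
  mod-divisor {q} r (t , e) =
    t Z.* + r , trans e (trans (cong (t Z.*_) (ZP.pos-* r q)) (sym (ZP.*-assoc t (+ r) (+ q))))

  mod-cancel : ∀ {q} r .{{_ : NonZero r}} {a b} →
               + r Z.* a ≡ + r Z.* b [mod r N.* q ] → a ≡ b [mod q ]
  mod-cancel {q} r {a} {b} (t , e) = t , ZP.*-cancelˡ-≡ (+ r) _ _ (begin
      + r Z.* (a Z.- b)          ≡⟨ expand (+ r) a b ⟩
      + r Z.* a Z.- + r Z.* b    ≡⟨ e ⟩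
      t Z.* + (r N.* q)          ≡⟨ cong (t Z.*_) (ZP.pos-* r q) ⟩
      t Z.* (+ r Z.* + q)        ≡⟨ swap t (+ r) (+ q) ⟩
      + r Z.* (t Z.* + q)        ∎)
    where
    open ≡-Reasoning
    expand : ∀ r a b → r Z.* (a Z.- b) ≡ r Z.* a Z.- r Z.* b
    expand = solve-∀
    swap : ∀ t r q → t Z.* (r Z.* q) ≡ r Z.* (t Z.* q)
    swap = solve-∀

  mod⇒%≡ : ∀ {q} .{{_ : NonZero q}} {a b} → + a ≡ + b [mod q ] → a % q ≡ b % q
  mod⇒%≡ {q} {a} {b} (+ k , e) = trans (cong (_% q) (shifted a b k e)) ([m+kn]%n≡m%n b k q)
    where
    shifted : ∀ a b k → + a Z.- + b ≡ + k Z.* + q → a ≡ b N.+ k N.* q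
    shifted a b k e = ZP.+-injective (begin
        + a                        ≡⟨ lemma (+ a) (+ b) ⟩
        (+ a Z.- + b) Z.+ + b      ≡⟨ cong (Z._+ + b) e ⟩
        + k Z.* + q Z.+ + b        ≡⟨ cong (Z._+ + b) (sym (ZP.pos-* k q)) ⟩
        + (k N.* q) Z.+ + b        ≡⟨ ZP.+-comm (+ (k N.* q)) (+ b) ⟩
        + (b N.+ k N.* q)          ∎)
      where
      open ≡-Reasoning
      lemma : ∀ a b → a ≡ (a Z.- b) Z.+ b
      lemma = solve-∀
  mod⇒%≡ {q} {a} {b} h@(-[1+ k ] , e) = sym (mod⇒%≡ (mod-sym h))

  %-mod : ∀ {q} .{{_ : NonZero q}} a → + (a % q) ≡ + a [mod q ]
  %-mod {q} a = mod-sym (+ (a / q) , (begin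
      + a Z.- + (a % q)
        ≡⟨ cong (λ z → + z Z.- + (a % q)) (m≡m%n+[m/n]*n a q) ⟩
      + (a % q N.+ (a / q) N.* q) Z.- + (a % q)
        ≡⟨ cong (Z._- + (a % q)) (trans (ZP.pos-+ (a % q) _) (cong (λ w → + (a % q) Z.+ w) (ZP.pos-* (a / q) q))) ⟩
      (+ (a % q) Z.+ + (a / q) Z.* + q) Z.- + (a % q)
        ≡⟨ cancel (+ (a % q)) (+ (a / q)) (+ q) ⟩
      + (a / q) Z.* + q ∎))
    where
    open ≡-Reasoning
    cancel : ∀ r s q → (r Z.+ s Z.* q) Z.- r ≡ s Z.* q
    cancel = solve-∀

  mod-unique : ∀ {q} .{{_ : NonZero q}} {a b} → a < q → b < q → + a ≡ + b [mod q ] → a ≡ b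
  mod-unique a<q b<q h = trans (sym (m<n⇒m%n≡m a<q)) (trans (mod⇒%≡ h) (m<n⇒m%n≡m b<q))

-- The p-adic integers of Defs are digit streams; all arithmetic facts
-- about them are reduced to congruences between their truncations
-- trunc x N = x mod p^N, which are ordinary natural numbers.
module Digits (p : ℕ) (pr : Prime p) where

  open import Defs
  open import Data.Nat as N using (zero; suc; NonZero; _≤_; _<_; z≤n; s≤s)
  import Data.Nat.Properties as NP
  open import Data.Nat.Primality using (prime⇒nonZero)
  open import Data.Nat.DivMod using (_/_; _%_; _mod_; m≡m%n+[m/n]*n; [m+kn]%n≡m%n; m<n⇒m%n≡m; m%n<n; n%1≡0)
  open import Data.Nat.Tactic.RingSolver as NS using ()
  open import Data.Integer as Z using (ℤ; +_)
  import Data.Integer.Properties as ZP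
  open import Data.Integer.Tactic.RingSolver using (solve-∀)
  open import Data.Fin using (toℕ)
  import Data.Fin.Properties as FP
  open import Data.Sum using (inj₁; inj₂)
  open import Relation.Binary.PropositionalEquality

  open Congruence

  instance
    p≢0 : NonZero p
    p≢0 = prime⇒nonZero pr

  p^≢0 : ∀ k → NonZero (p N.^ k)
  p^≢0 k = NP.m^n≢0 p k

  _%p^_ _/p^_ : ℕ → ℕ → ℕ
  X %p^ m = (X % p N.^ m) {{p^≢0 m}}
  X /p^ m = (X / p N.^ m) {{p^≢0 m}}

  Zp : Set
  Zp = ℤp p pr

  tr : Zp → ℕ → ℕ
  tr = trunc p pr

  ⟦_⟧ : Zp → ℕ → ℤ
  ⟦ x ⟧ N = + tr x N

  append-digit-< : ∀ {t a d} → t < a → d < p → t N.+ d N.* a < p N.* a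
  append-digit-< {t} {a} {d} t<a d<p =
    NP.<-≤-trans (NP.+-monoˡ-< (d N.* a) t<a) (NP.*-monoˡ-≤ a d<p)

  tr-bound : ∀ x m → tr x m < p N.^ m
  tr-bound x zero    = s≤s z≤n
  tr-bound x (suc m) = append-digit-< (tr-bound x m) (FP.toℕ<n (x m))

  residue-split : ∀ X m → X %p^ suc m ≡ X %p^ m N.+ ((X /p^ m) % p) N.* p N.^ m
  residue-split X m = trans (cong (_%p^ suc m) X≡r+kq)
                        (trans ([m+kn]%n≡m%n r k (p N.^ suc m)) (m<n⇒m%n≡m r<p^sm))
    where
    instance
      _ = p^≢0 m
      _ = p^≢0 (suc m)
    A = p N.^ m
    r = X % A N.+ ((X / A) % p) N.* A
    k = X / A / p
    X≡r+kq : X ≡ r N.+ k N.* (p N.^ suc m)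
    X≡r+kq = begin
        X                                          ≡⟨ m≡m%n+[m/n]*n X A ⟩
        X % A N.+ (X / A) N.* A                    ≡⟨ cong (λ z → X % A N.+ z N.* A) (m≡m%n+[m/n]*n (X / A) p) ⟩
        X % A N.+ ((X / A) % p N.+ k N.* p) N.* A  ≡⟨ regroup (X % A) ((X / A) % p) k p A ⟩
        r N.+ k N.* (p N.* A)                      ∎
      where
      open ≡-Reasoning
      regroup : ∀ u v w p a → u N.+ (v N.+ w N.* p) N.* a ≡ (u N.+ v N.* a) N.+ w N.* (p N.* a)
      regroup = NS.solve-∀
    r<p^sm : r < p N.^ suc m
    r<p^sm = append-digit-< (m%n<n X A) (m%n<n (X / A) p)

  mod-weaken : ∀ {m n a b} → m ≤ n → a ≡ b [mod p N.^ n ] → a ≡ b [mod p N.^ m ]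
  mod-weaken {m} {n} m≤n h = mod-divisor (p N.^ (n N.∸ m)) (subst (λ q → _ ≡ _ [mod q ]) split h)
    where
    split : p N.^ n ≡ p N.^ (n N.∸ m) N.* p N.^ m
    split = trans (cong (p N.^_) (sym (NP.m∸n+n≡m m≤n))) (NP.^-distribˡ-+-* p (n N.∸ m) m)

  mod-weaken₁ : ∀ {m a b} → a ≡ b [mod p N.^ suc m ] → a ≡ b [mod p N.^ m ]
  mod-weaken₁ {m} = mod-weaken (NP.n≤1+n m)

  -- Every operation on ℤ_p in Defs is of this form.
  module Limit (F : ℕ → ℕ) (compatible : ∀ m → + F m ≡ + F (suc m) [mod p N.^ m ]) where

    limit : Zp
    limit n = (F (suc n) /p^ n) mod p

    tr-limit : ∀ m → tr limit m ≡ F m %p^ m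
    tr-limit zero    = sym (n%1≡0 (F 0))
    tr-limit (suc m) = begin
        tr limit m N.+ toℕ (limit m) N.* p N.^ m
          ≡⟨ cong₂ (λ u v → u N.+ v N.* p N.^ m) (tr-limit m) (FP.toℕ-fromℕ< (m%n<n (F (suc m) / p N.^ m) p)) ⟩
        F m % p N.^ m N.+ ((F (suc m) / p N.^ m) % p) N.* p N.^ m
          ≡⟨ cong (N._+ ((F (suc m) / p N.^ m) % p) N.* p N.^ m) (mod⇒%≡ (compatible m)) ⟩
        F (suc m) % p N.^ m N.+ ((F (suc m) / p N.^ m) % p) N.* p N.^ m
          ≡⟨ sym (residue-split (F (suc m)) m) ⟩
        F (suc m) % p N.^ suc m ∎
      where
      open ≡-Reasoning
      instance
        _ = p^≢0 m
        _ = p^≢0 (suc m)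

    limit-mod : ∀ m → ⟦ limit ⟧ m ≡ + F m [mod p N.^ m ]
    limit-mod m = subst (λ u → + u ≡ + F m [mod p N.^ m ]) (sym (tr-limit m)) (%-mod {{p^≢0 m}} (F m))

  tr-step : ∀ x m → ⟦ x ⟧ m ≡ ⟦ x ⟧ (suc m) [mod p N.^ m ]
  tr-step x m = mod-sym (+ toℕ (x m) , (begin
      + (tr x m N.+ toℕ (x m) N.* p N.^ m) Z.- + tr x m
        ≡⟨ cong (Z._- + tr x m) (trans (ZP.pos-+ (tr x m) _) (cong (λ w → + tr x m Z.+ w) (ZP.pos-* (toℕ (x m)) (p N.^ m)))) ⟩
      (+ tr x m Z.+ + toℕ (x m) Z.* + (p N.^ m)) Z.- + tr x m
        ≡⟨ cancel (+ tr x m) (+ toℕ (x m)) (+ (p N.^ m)) ⟩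
      + toℕ (x m) Z.* + (p N.^ m) ∎))
    where
    open ≡-Reasoning
    cancel : ∀ a b c → (a Z.+ b Z.* c) Z.- a ≡ b Z.* c
    cancel = solve-∀

  tr-level : ∀ x {m n} → m ≤ n → ⟦ x ⟧ m ≡ ⟦ x ⟧ n [mod p N.^ m ]
  tr-level x {m} {zero}  z≤n   = mod-refl
  tr-level x {m} {suc n} m≤1+n with NP.m≤n⇒m<n∨m≡n m≤1+n
  ... | inj₂ refl       = mod-refl
  ... | inj₁ (s≤s m≤n) = mod-trans (tr-level x m≤n) (mod-weaken m≤n (tr-step x n))

  nat : ℕ → Zp
  nat = ℕ→ℤp p pr

  nat-tr : ∀ M N → ⟦ nat M ⟧ N ≡ + M [mod p N.^ N ]
  nat-tr M = Limit.limit-mod (λ _ → M) (λ m → mod-refl)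

  add-tr : ∀ x y N → ⟦ _+ℤp_ p pr x y ⟧ N ≡ ⟦ x ⟧ N Z.+ ⟦ y ⟧ N [mod p N.^ N ]
  add-tr x y = Limit.limit-mod (λ m → tr x m N.+ tr y m) (λ m → mod-+ (tr-step x m) (tr-step y m))

  mul-tr : ∀ x y N → ⟦ _*ℤp_ p pr x y ⟧ N ≡ ⟦ x ⟧ N Z.* ⟦ y ⟧ N [mod p N.^ N ]
  mul-tr x y N = mod-trans (Limit.limit-mod F compatible N) (mod-≡ (ZP.pos-* (tr x N) (tr y N)))
    where
    F = λ m → tr x m N.* tr y m
    compatible : ∀ m → + F m ≡ + F (suc m) [mod p N.^ m ]
    compatible m = mod-trans (mod-≡ (ZP.pos-* (tr x m) (tr y m)))
                     (mod-trans (mod-* (tr-step x m) (tr-step y m))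
                                (mod-≡ (sym (ZP.pos-* (tr x (suc m)) (tr y (suc m))))))

  -- -x is defined through p^N ∸ (x mod p^N), which is ≡ -x mod p^N
  complement-mod : ∀ x m → + (p N.^ m N.∸ tr x m) ≡ Z.- ⟦ x ⟧ m [mod p N.^ m ]
  complement-mod x m = mod-trans (mod-≡ (pos-∸ (NP.<⇒≤ (tr-bound x m))))
                         (mod-trans (mod-+ p^m≡0 (mod-refl {a = Z.- ⟦ x ⟧ m})) (mod-≡ (ZP.+-identityˡ _)))
    where
    pos-∸ : ∀ {a t} → t ≤ a → + (a N.∸ t) ≡ + a Z.- + t
    pos-∸ {a} {t} t≤a = trans (shift (+ (a N.∸ t)) (+ t)) (cong (λ w → + w Z.- + t) (NP.m∸n+n≡m t≤a))
      where
      shift : ∀ u v → u ≡ (u Z.+ v) Z.- v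
      shift = solve-∀
    p^m≡0 : + (p N.^ m) ≡ Z.0ℤ [mod p N.^ m ]
    p^m≡0 = subst (λ w → w ≡ Z.0ℤ [mod p N.^ m ]) (ZP.*-identityˡ _) (mod-multiple (+ 1))

  neg-tr : ∀ x N → ⟦ -ℤp_ p pr x ⟧ N ≡ Z.- ⟦ x ⟧ N [mod p N.^ N ]
  neg-tr x N = mod-trans (Limit.limit-mod (λ m → p N.^ m N.∸ tr x m) compatible N) (complement-mod x N)
    where
    compatible : ∀ m → + (p N.^ m N.∸ tr x m) ≡ + (p N.^ suc m N.∸ tr x (suc m)) [mod p N.^ m ]
    compatible m = mod-trans (complement-mod x m)
                     (mod-trans (mod-neg (tr-step x m)) (mod-sym (mod-weaken₁ {m = m} (complement-mod x (suc m)))))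

  _≈p_ : Zp → Zp → Set
  _≈p_ = _≈ℤp_ p pr

  ≈p⇒tr≡ : ∀ {x y} → x ≈p y → ∀ N → tr x N ≡ tr y N
  ≈p⇒tr≡ e zero    = refl
  ≈p⇒tr≡ e (suc N) = cong₂ (λ u v → u N.+ toℕ v N.* p N.^ N) (≈p⇒tr≡ e N) (e N)

  ≈p⇒mod : ∀ {x y} → x ≈p y → ∀ N → ⟦ x ⟧ N ≡ ⟦ y ⟧ N [mod p N.^ N ]
  ≈p⇒mod e N = mod-≡ (cong +_ (≈p⇒tr≡ e N))

  mod⇒≈p : ∀ {x y} → (∀ N → ⟦ x ⟧ N ≡ ⟦ y ⟧ N [mod p N.^ N ]) → x ≈p y
  mod⇒≈p {x} {y} h n =
    FP.toℕ-injective (NP.*-cancelʳ-≡ (toℕ (x n)) (toℕ (y n)) (p N.^ n) {{p^≢0 n}}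
      (NP.+-cancelˡ-≡ (tr x n) _ _ (trans (tr≡ (suc n)) (cong (N._+ toℕ (y n) N.* p N.^ n) (sym (tr≡ n))))))
    where
    tr≡ : ∀ m → tr x m ≡ tr y m
    tr≡ m = mod-unique {{p^≢0 m}} (tr-bound x m) (tr-bound y m) (h m)

-- An equation between ring
-- expressions over ℚ_p is reduced, after clearing the p-power
-- denominators, to congruences mod p^N between integer polynomials in
-- the truncations of the numerators; these are then closed by the
-- integer ring solver.
module Rationals (p : ℕ) (pr : Prime p) where

  open import Defs
  open import Data.Nat as N using (zero; suc; _≤_)
  import Data.Nat.Properties as NP
  open import Data.Integer as Z using (ℤ; +_; -[1+_])
  import Data.Integer.Properties as ZP
  open import Data.Integer.Tactic.RingSolver using (solve-∀)
  open import Data.Product using (_,_; proj₁; proj₂)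
  open import Relation.Binary.PropositionalEquality as ≡ using (_≡_)
  open import Algebra.Structures using (IsCommutativeRing)

  open Congruence
  open Digits p pr

  Q : Set
  Q = ℚp p pr

  infixl 6 _+Q_
  infixl 7 _*Q_
  _+Q_ _*Q_ : Q → Q → Q
  _+Q_ = _+ℚp_ p pr
  _*Q_ = _*ℚp_ p pr

  -Q_ : Q → Q
  -Q_ = -ℚp_ p pr

  0Q 1Q : Q
  0Q = 0ℚp p pr
  1Q = 1ℚp p pr

  infix 4 _≈Q_
  _≈Q_ : Q → Q → Set
  _≈Q_ = _≈ℚp_ p pr

  intQ : ℤ → Q
  intQ (+ n)     = nat n , 0
  intQ -[1+ n ] = -Q (nat (suc n) , 0)

  P^ : ℕ → ℤ
  P^ k = + (p N.^ k)

  P^-+ : ∀ k l → P^ (k N.+ l) ≡ P^ k Z.* P^ l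
  P^-+ k l = ≡.trans (≡.cong +_ (NP.^-distribˡ-+-* p k l)) (ZP.pos-* (p N.^ k) (p N.^ l))

  infixl 6 _⊕_
  infixl 7 _⊗_
  data Expr : Set where
    val     : Q → Expr
    int     : ℤ → Expr
    _⊕_ _⊗_ : Expr → Expr → Expr
    ⊖_      : Expr → Expr

  ⟪_⟫ : Expr → Q
  ⟪ val x ⟫ = x
  ⟪ int i ⟫ = intQ i
  ⟪ s ⊕ t ⟫ = ⟪ s ⟫ +Q ⟪ t ⟫
  ⟪ s ⊗ t ⟫ = ⟪ s ⟫ *Q ⟪ t ⟫
  ⟪ ⊖ s ⟫   = -Q ⟪ s ⟫

  den : Expr → ℤ
  den (val x) = P^ (proj₂ x)
  den (int i) = + 1
  den (s ⊕ t) = den s Z.* den t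
  den (s ⊗ t) = den s Z.* den t
  den (⊖ s)   = den s

  num : Expr → ℕ → ℤ
  num (val x) N = ⟦ proj₁ x ⟧ N
  num (int i) N = i
  num (s ⊕ t) N = num s N Z.* den t Z.+ num t N Z.* den s
  num (s ⊗ t) N = num s N Z.* num t N
  num (⊖ s)   N = Z.- num s N

  den-correct : ∀ s → P^ (proj₂ ⟪ s ⟫) ≡ den s
  den-correct (val x)  = ≡.refl
  den-correct (int (+ n))     = ≡.refl
  den-correct (int -[1+ n ]) = ≡.refl
  den-correct (s ⊕ t) = ≡.trans (P^-+ (proj₂ ⟪ s ⟫) (proj₂ ⟪ t ⟫)) (≡.cong₂ Z._*_ (den-correct s) (den-correct t))
  den-correct (s ⊗ t) = ≡.trans (P^-+ (proj₂ ⟪ s ⟫) (proj₂ ⟪ t ⟫)) (≡.cong₂ Z._*_ (den-correct s) (den-correct t))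
  den-correct (⊖ s)   = den-correct s

  num-correct : ∀ s N → ⟦ proj₁ ⟪ s ⟫ ⟧ N ≡ num s N [mod p N.^ N ]
  num-correct (val x) N        = mod-refl
  num-correct (int (+ n)) N    = nat-tr n N
  num-correct (int -[1+ n ]) N = mod-trans (neg-tr _ N) (mod-neg (nat-tr (suc n) N))
  num-correct (s ⊕ t) N =
    mod-trans (add-tr _ _ N) (mod-+ (scaled s t) (scaled t s))
    where
    scaled : ∀ s t → ⟦ _*ℤp_ p pr (proj₁ ⟪ s ⟫) (nat (p N.^ proj₂ ⟪ t ⟫)) ⟧ N ≡ num s N Z.* den t [mod p N.^ N ]
    scaled s t = mod-trans (mul-tr _ _ N) (mod-* (num-correct s N) (mod-trans (nat-tr _ N) (mod-≡ (den-correct t))))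
  num-correct (s ⊗ t) N = mod-trans (mul-tr _ _ N) (mod-* (num-correct s N) (num-correct t N))
  num-correct (⊖ s)   N = mod-trans (neg-tr _ N) (mod-neg (num-correct s N))

  -- (x , k) ≈ (y , l) means x p^l ≈ y p^k, i.e. the congruences
  -- CrossMod s t N of cross products modulo every p^N
  CrossMod : Expr → Expr → ℕ → Set
  CrossMod s t N = num s N Z.* den t ≡ num t N Z.* den s [mod p N.^ N ]

  cross-mod : ∀ s t N →
    ⟦ _*ℤp_ p pr (proj₁ ⟪ s ⟫) (nat (p N.^ proj₂ ⟪ t ⟫)) ⟧ N ≡ num s N Z.* den t [mod p N.^ N ]
  cross-mod s t N = mod-trans (mul-tr _ _ N) (mod-* (num-correct s N) (mod-trans (nat-tr _ N) (mod-≡ (den-correct t))))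

  ≈Q-intro : ∀ s t → (∀ N → CrossMod s t N) → ⟪ s ⟫ ≈Q ⟪ t ⟫
  ≈Q-intro s t h = mod⇒≈p λ N → mod-trans (cross-mod s t N) (mod-trans (h N) (mod-sym (cross-mod t s N)))

  ≈Q-elim : ∀ s t → ⟪ s ⟫ ≈Q ⟪ t ⟫ → ∀ N → CrossMod s t N
  ≈Q-elim s t e N = mod-trans (mod-sym (cross-mod s t N)) (mod-trans (≈p⇒mod e N) (cross-mod t s N))

  ≈Q-by-identity : ∀ s t → (∀ N → num s N Z.* den t ≡ num t N Z.* den s) → ⟪ s ⟫ ≈Q ⟪ t ⟫
  ≈Q-by-identity s t h = ≈Q-intro s t (λ N → mod-≡ (h N))

  num-level : ∀ s {n N} → n ≤ N → num s N ≡ num s n [mod p N.^ n ]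
  num-level s {n} {N} n≤N = mod-trans (mod-sym (mod-weaken n≤N (num-correct s N)))
                              (mod-trans (mod-sym (tr-level _ n≤N)) (num-correct s n))

  ≈Q-intro-scaled : ∀ s t e →
    (∀ N → P^ e Z.* (num s (e N.+ N) Z.* den t) ≡ P^ e Z.* (num t (e N.+ N) Z.* den s) [mod p N.^ (e N.+ N) ]) →
    ⟪ s ⟫ ≈Q ⟪ t ⟫
  ≈Q-intro-scaled s t e h = ≈Q-intro s t λ N →
    mod-trans (mod-* (mod-sym (num-level s (NP.m≤n+m N e))) mod-refl)
      (mod-trans (mod-cancel (p N.^ e) {{p^≢0 e}}
                   (≡.subst (λ q → P^ e Z.* (num s (e N.+ N) Z.* den t) ≡ P^ e Z.* (num t (e N.+ N) Z.* den s) [mod q ])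
                            (NP.^-distribˡ-+-* p e N) (h N)))
        (mod-* (num-level t (NP.m≤n+m N e)) mod-refl))

  X : Q → ℕ → ℤ
  X x N = ⟦ proj₁ x ⟧ N

  D : Q → ℤ
  D x = P^ (proj₂ x)

  -- Transitivity needs the scaled criterion, because
  -- the middle term's denominator has to be cancelled; every other law
  -- is an integer identity (or a linear combination of hypotheses)
  -- after clearing denominators.
  ≈Q-refl : ∀ {x} → x ≈Q x
  ≈Q-refl n = ≡.refl

  ≈Q-sym : ∀ {x y} → x ≈Q y → y ≈Q x
  ≈Q-sym e n = ≡.sym (e n)

  ≈Q-trans : ∀ {x y z} → x ≈Q y → y ≈Q z → x ≈Q z
  ≈Q-trans {x} {y} {z} e1 e2 = ≈Q-intro-scaled (val x) (val z) (proj₂ y) λ N →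
    mod-combination₂ (D z) (D x) (identity (X x (proj₂ y N.+ N)) (X y (proj₂ y N.+ N)) (X z (proj₂ y N.+ N)) (D x) (D y) (D z))
      (≈Q-elim (val x) (val y) e1 (proj₂ y N.+ N)) (≈Q-elim (val y) (val z) e2 (proj₂ y N.+ N))
    where
    identity : ∀ xx xy xz px py pz → py Z.* (xx Z.* pz) Z.- py Z.* (xz Z.* px)
          ≡ pz Z.* (xx Z.* py Z.- xy Z.* px) Z.+ px Z.* (xy Z.* pz Z.- xz Z.* py)
    identity = solve-∀

  +Q-cong : ∀ {x x′ y y′} → x ≈Q x′ → y ≈Q y′ → (x +Q y) ≈Q (x′ +Q y′)
  +Q-cong {x} {x′} {y} {y′} e1 e2 = ≈Q-intro (val x ⊕ val y) (val x′ ⊕ val y′) λ N →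
    mod-combination₂ (D y Z.* D y′) (D x Z.* D x′) (identity (X x N) (X x′ N) (X y N) (X y′ N) (D x) (D x′) (D y) (D y′))
      (≈Q-elim (val x) (val x′) e1 N) (≈Q-elim (val y) (val y′) e2 N)
    where
    identity : ∀ xx xx′ xy xy′ px px′ py py′ →
          (xx Z.* py Z.+ xy Z.* px) Z.* (px′ Z.* py′) Z.- (xx′ Z.* py′ Z.+ xy′ Z.* px′) Z.* (px Z.* py)
          ≡ py Z.* py′ Z.* (xx Z.* px′ Z.- xx′ Z.* px) Z.+ px Z.* px′ Z.* (xy Z.* py′ Z.- xy′ Z.* py)
    identity = solve-∀

  *Q-cong : ∀ {x x′ y y′} → x ≈Q x′ → y ≈Q y′ → (x *Q y) ≈Q (x′ *Q y′)
  *Q-cong {x} {x′} {y} {y′} e1 e2 = ≈Q-intro (val x ⊗ val y) (val x′ ⊗ val y′) λ N →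
    mod-combination₂ (X y N Z.* D y′) (X x′ N Z.* D x) (identity (X x N) (X x′ N) (X y N) (X y′ N) (D x) (D x′) (D y) (D y′))
      (≈Q-elim (val x) (val x′) e1 N) (≈Q-elim (val y) (val y′) e2 N)
    where
    identity : ∀ xx xx′ xy xy′ px px′ py py′ →
          (xx Z.* xy) Z.* (px′ Z.* py′) Z.- (xx′ Z.* xy′) Z.* (px Z.* py)
          ≡ xy Z.* py′ Z.* (xx Z.* px′ Z.- xx′ Z.* px) Z.+ xx′ Z.* px Z.* (xy Z.* py′ Z.- xy′ Z.* py)
    identity = solve-∀

  -Q-cong : ∀ {x x′} → x ≈Q x′ → (-Q x) ≈Q (-Q x′)
  -Q-cong {x} {x′} e1 = ≈Q-intro (⊖ val x) (⊖ val x′) λ N →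
    mod-combination₁ (Z.- + 1) (identity (X x N) (X x′ N) (D x) (D x′)) (≈Q-elim (val x) (val x′) e1 N)
    where
    identity : ∀ xx xx′ px px′ → Z.- xx Z.* px′ Z.- Z.- xx′ Z.* px ≡ Z.- + 1 Z.* (xx Z.* px′ Z.- xx′ Z.* px)
    identity = solve-∀

  +Q-assoc : ∀ x y z → ((x +Q y) +Q z) ≈Q (x +Q (y +Q z))
  +Q-assoc x y z = ≈Q-by-identity ((val x ⊕ val y) ⊕ val z) (val x ⊕ (val y ⊕ val z))
    λ N → identity (X x N) (X y N) (X z N) (D x) (D y) (D z)
    where
    identity : ∀ a b c pa pb pc → ((a Z.* pb Z.+ b Z.* pa) Z.* pc Z.+ c Z.* (pa Z.* pb)) Z.* (pa Z.* (pb Z.* pc))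
          ≡ (a Z.* (pb Z.* pc) Z.+ (b Z.* pc Z.+ c Z.* pb) Z.* pa) Z.* ((pa Z.* pb) Z.* pc)
    identity = solve-∀

  +Q-comm : ∀ x y → (x +Q y) ≈Q (y +Q x)
  +Q-comm x y = ≈Q-by-identity (val x ⊕ val y) (val y ⊕ val x)
    λ N → identity (X x N) (X y N) (D x) (D y)
    where
    identity : ∀ a b pa pb → (a Z.* pb Z.+ b Z.* pa) Z.* (pb Z.* pa) ≡ (b Z.* pa Z.+ a Z.* pb) Z.* (pa Z.* pb)
    identity = solve-∀

  +Q-idˡ : ∀ x → (0Q +Q x) ≈Q x
  +Q-idˡ x = ≈Q-by-identity (int (+ 0) ⊕ val x) (val x) λ N → identity (X x N) (D x)
    where
    identity : ∀ a pa → (+ 0 Z.* pa Z.+ a Z.* + 1) Z.* pa ≡ a Z.* (+ 1 Z.* pa)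
    identity = solve-∀

  +Q-idʳ : ∀ x → (x +Q 0Q) ≈Q x
  +Q-idʳ x = ≈Q-by-identity (val x ⊕ int (+ 0)) (val x) λ N → identity (X x N) (D x)
    where
    identity : ∀ a pa → (a Z.* + 1 Z.+ + 0 Z.* pa) Z.* pa ≡ a Z.* (pa Z.* + 1)
    identity = solve-∀

  -Q-invˡ : ∀ x → ((-Q x) +Q x) ≈Q 0Q
  -Q-invˡ x = ≈Q-by-identity (⊖ val x ⊕ val x) (int (+ 0)) λ N → identity (X x N) (D x)
    where
    identity : ∀ a pa → (Z.- a Z.* pa Z.+ a Z.* pa) Z.* + 1 ≡ + 0 Z.* (pa Z.* pa)
    identity = solve-∀

  -Q-invʳ : ∀ x → (x +Q (-Q x)) ≈Q 0Q
  -Q-invʳ x = ≈Q-by-identity (val x ⊕ ⊖ val x) (int (+ 0)) λ N → identity (X x N) (D x)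
    where
    identity : ∀ a pa → (a Z.* pa Z.+ Z.- a Z.* pa) Z.* + 1 ≡ + 0 Z.* (pa Z.* pa)
    identity = solve-∀

  *Q-assoc : ∀ x y z → ((x *Q y) *Q z) ≈Q (x *Q (y *Q z))
  *Q-assoc x y z = ≈Q-by-identity ((val x ⊗ val y) ⊗ val z) (val x ⊗ (val y ⊗ val z))
    λ N → identity (X x N) (X y N) (X z N) (D x) (D y) (D z)
    where
    identity : ∀ a b c pa pb pc → ((a Z.* b) Z.* c) Z.* (pa Z.* (pb Z.* pc)) ≡ (a Z.* (b Z.* c)) Z.* ((pa Z.* pb) Z.* pc)
    identity = solve-∀

  *Q-comm : ∀ x y → (x *Q y) ≈Q (y *Q x)
  *Q-comm x y = ≈Q-by-identity (val x ⊗ val y) (val y ⊗ val x)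
    λ N → identity (X x N) (X y N) (D x) (D y)
    where
    identity : ∀ a b pa pb → (a Z.* b) Z.* (pb Z.* pa) ≡ (b Z.* a) Z.* (pa Z.* pb)
    identity = solve-∀

  *Q-idˡ : ∀ x → (1Q *Q x) ≈Q x
  *Q-idˡ x = ≈Q-by-identity (int (+ 1) ⊗ val x) (val x) λ N → identity (X x N) (D x)
    where
    identity : ∀ a pa → (+ 1 Z.* a) Z.* pa ≡ a Z.* (+ 1 Z.* pa)
    identity = solve-∀

  *Q-idʳ : ∀ x → (x *Q 1Q) ≈Q x
  *Q-idʳ x = ≈Q-by-identity (val x ⊗ int (+ 1)) (val x) λ N → identity (X x N) (D x)
    where
    identity : ∀ a pa → (a Z.* + 1) Z.* pa ≡ a Z.* (pa Z.* + 1)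
    identity = solve-∀

  distribˡ : ∀ x y z → (x *Q (y +Q z)) ≈Q ((x *Q y) +Q (x *Q z))
  distribˡ x y z = ≈Q-by-identity (val x ⊗ (val y ⊕ val z)) ((val x ⊗ val y) ⊕ (val x ⊗ val z))
    λ N → identity (X x N) (X y N) (X z N) (D x) (D y) (D z)
    where
    identity : ∀ a b c pa pb pc → (a Z.* (b Z.* pc Z.+ c Z.* pb)) Z.* ((pa Z.* pb) Z.* (pa Z.* pc))
          ≡ ((a Z.* b) Z.* (pa Z.* pc) Z.+ (a Z.* c) Z.* (pa Z.* pb)) Z.* (pa Z.* (pb Z.* pc))
    identity = solve-∀

  distribʳ : ∀ x y z → ((y +Q z) *Q x) ≈Q ((y *Q x) +Q (z *Q x))
  distribʳ x y z = ≈Q-by-identity ((val y ⊕ val z) ⊗ val x) ((val y ⊗ val x) ⊕ (val z ⊗ val x))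
    λ N → identity (X x N) (X y N) (X z N) (D x) (D y) (D z)
    where
    identity : ∀ a b c pa pb pc → ((b Z.* pc Z.+ c Z.* pb) Z.* a) Z.* ((pb Z.* pa) Z.* (pc Z.* pa))
          ≡ ((b Z.* a) Z.* (pc Z.* pa) Z.+ (c Z.* a) Z.* (pb Z.* pa)) Z.* ((pb Z.* pc) Z.* pa)
    identity = solve-∀

  -- ≈Q packed in a record, so that implicit arguments of the ring laws
  -- can be inferred from the equality type
  infix 4 _≋_
  record _≋_ (x y : Q) : Set where
    constructor ⟨_⟩
    field un : x ≈Q y
  open _≋_ public

  isCommutativeRing : IsCommutativeRing _≋_ _+Q_ _*Q_ -Q_ 0Q 1Q
  isCommutativeRing = record
    { isRing = record
      { +-isAbelianGroup = record
        { isGroup = record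
          { isMonoid = record
            { isSemigroup = record
              { isMagma = record
                { isEquivalence = record
                  { refl  = λ {x} → ⟨ ≈Q-refl {x} ⟩
                  ; sym   = λ {x} {y} e → ⟨ ≈Q-sym {x} {y} (un e) ⟩
                  ; trans = λ {x} {y} {z} e f → ⟨ ≈Q-trans {x} {y} {z} (un e) (un f) ⟩ }
                ; ∙-cong = λ {x} {y} {u} {v} e f → ⟨ +Q-cong {x} {y} {u} {v} (un e) (un f) ⟩ }
              ; assoc = λ x y z → ⟨ +Q-assoc x y z ⟩ }
            ; identity = (λ x → ⟨ +Q-idˡ x ⟩) , (λ x → ⟨ +Q-idʳ x ⟩) }
          ; inverse = (λ x → ⟨ -Q-invˡ x ⟩) , (λ x → ⟨ -Q-invʳ x ⟩)
          ; ⁻¹-cong = λ {x} {y} e → ⟨ -Q-cong {x} {y} (un e) ⟩ }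
        ; comm = λ x y → ⟨ +Q-comm x y ⟩ }
      ; *-cong = λ {x} {y} {u} {v} e f → ⟨ *Q-cong {x} {y} {u} {v} (un e) (un f) ⟩
      ; *-assoc = λ x y z → ⟨ *Q-assoc x y z ⟩
      ; *-identity = (λ x → ⟨ *Q-idˡ x ⟩) , (λ x → ⟨ *Q-idʳ x ⟩)
      ; distrib = (λ x y z → ⟨ distribˡ x y z ⟩) , (λ x y z → ⟨ distribʳ x y z ⟩) }
    ; *-comm = λ x y → ⟨ *Q-comm x y ⟩ }

  ℚp-ring : CommutativeRing 0ℓ 0ℓ
  ℚp-ring = record { isCommutativeRing = isCommutativeRing }

  -- ℤ → ℚ_p is a ring homomorphism; this makes the integer-coefficient
  -- ring solver available over ℚ_p
  ℤ→ℚp : Z.+-*-rawRing -Raw-AlmostCommutative⟶ fromCommutativeRing ℚp-ring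
  ℤ→ℚp = record
    { ⟦_⟧    = intQ
    ; +-homo = λ i j → ⟨ ≈Q-by-identity (int (i Z.+ j)) (int i ⊕ int j) (λ N → +-identity i j) ⟩
    ; *-homo = λ i j → ⟨ ≈Q-by-identity (int (i Z.* j)) (int i ⊗ int j) (λ N → *-identity i j) ⟩
    ; -‿homo = λ i → ⟨ ≈Q-by-identity (int (Z.- i)) (⊖ int i) (λ N → ≡.refl) ⟩
    ; 0-homo = ⟨ (λ n → ≡.refl) ⟩
    ; 1-homo = ⟨ (λ n → ≡.refl) ⟩
    }
    where
    +-identity : ∀ i j → (i Z.+ j) Z.* (+ 1 Z.* + 1) ≡ (i Z.* + 1 Z.+ j Z.* + 1) Z.* + 1
    +-identity = solve-∀
    *-identity : ∀ i j → (i Z.* j) Z.* (+ 1 Z.* + 1) ≡ (i Z.* j) Z.* + 1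
    *-identity = solve-∀

  p^-divisible : ∀ K x → x ≋ times _+Q_ 0Q (p N.^ K) (proj₁ x , proj₂ x N.+ K)
  p^-divisible K x = R.sym (R.trans (times-intQ (p N.^ K) _) divide)
    where
    module R = CommutativeRing ℚp-ring
    times-intQ : ∀ n y → times _+Q_ 0Q n y ≋ intQ (+ n) *Q y
    times-intQ zero    y = ⟨ ≈Q-by-identity (int (+ 0)) (int (+ 0) ⊗ val y) (λ N → zero-identity (D y)) ⟩
      where
      zero-identity : ∀ d → + 0 Z.* (+ 1 Z.* d) ≡ (+ 0 Z.* + 0) Z.* + 1
      zero-identity = solve-∀
    times-intQ (suc n) y = R.trans (R.+-cong R.refl (times-intQ n y))
      ⟨ ≈Q-by-identity (val y ⊕ int (+ n) ⊗ val y) (int (+ suc n) ⊗ val y) (λ N → suc-identity (+ n) (X y N) (D y)) ⟩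
      where
      suc-identity : ∀ n x d → (x Z.* (+ 1 Z.* d) Z.+ (n Z.* x) Z.* d) Z.* (+ 1 Z.* d)
                               ≡ ((+ 1 Z.+ n) Z.* x) Z.* (d Z.* (+ 1 Z.* d))
      suc-identity = solve-∀
    divide : intQ (P^ K) *Q (proj₁ x , proj₂ x N.+ K) ≋ x
    divide = ⟨ ≈Q-by-identity (int (P^ K) ⊗ val (proj₁ x , proj₂ x N.+ K)) (val x) (λ N →
      ≡.trans (identity (P^ K) (X x N) (D x)) (≡.cong (λ w → X x N Z.* (+ 1 Z.* w)) (≡.sym (P^-+ (proj₂ x) K)))) ⟩
      where
      identity : ∀ c x d → (c Z.* x) Z.* d ≡ x Z.* (+ 1 Z.* (d Z.* c))
      identity = solve-∀

-- An element with a nonzero digit is p^j times a p-adic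
-- unit, and a p-adic unit is invertible by Newton iteration
-- y ↦ y (2 - u y) starting from an inverse modulo p.  Since a
-- determinant ad - bc = 1 cannot have all of a, b, c, d divisible by
-- a high power of p, some entry of a matrix in SL₂(ℚ_p) is a unit.
module Units (p : ℕ) (pr : Prime p) where

  open import Defs
  open import Data.Nat as N using (zero; suc; NonZero; _<_)
  import Data.Nat.Properties as NP
  open import Data.Nat.Primality using (prime⇒nonTrivial)
  open import Data.Nat.Coprimality using (coprime-Bézout; prime⇒coprime)
  open import Data.Nat.GCD using (module Bézout)
  open import Data.Nat.Tactic.RingSolver as NS using ()
  open import Data.Integer as Z using (ℤ; +_)
  import Data.Integer.Properties as ZP
  open import Data.Integer.Tactic.RingSolver using (solve-∀)
  open import Data.Integer.DivMod using (_%ℕ_; _/ℕ_; a≡a%ℕn+[a/ℕn]*n)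
  open import Data.Fin using (toℕ)
  import Data.Fin.Properties as FP
  open import Data.Product using (Σ; _×_; _,_; proj₁; proj₂)
  open import Data.Sum using (_⊎_; inj₁; inj₂)
  open import Data.Empty using (⊥-elim)
  open import Relation.Nullary using (¬_; yes; no; Dec)
  open import Relation.Binary.PropositionalEquality

  open Congruence
  open Digits p pr
  open Rationals p pr

  Unit : Q → Set
  Unit x = Σ Q λ x′ → x *Q x′ ≋ 1Q

  %ℕ-mod : ∀ i m → + ((i %ℕ p N.^ m) {{p^≢0 m}}) ≡ i [mod p N.^ m ]
  %ℕ-mod i m = mod-sym ((i /ℕ p N.^ m) {{p^≢0 m}} , (begin
      i Z.- + r                            ≡⟨ cong (Z._- + r) (a≡a%ℕn+[a/ℕn]*n i (p N.^ m) {{p^≢0 m}}) ⟩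
      (+ r Z.+ k Z.* + (p N.^ m)) Z.- + r  ≡⟨ cancel (+ r) k (+ (p N.^ m)) ⟩
      k Z.* + (p N.^ m)                    ∎))
    where
    open ≡-Reasoning
    r = (i %ℕ p N.^ m) {{p^≢0 m}}
    k = (i /ℕ p N.^ m) {{p^≢0 m}}
    cancel : ∀ r s q → (r Z.+ s Z.* q) Z.- r ≡ s Z.* q
    cancel = solve-∀

  inverse-mod-p : ∀ d → .{{NonZero d}} → d < p → Σ ℤ λ y → + d Z.* y ≡ + 1 [mod p ]
  inverse-mod-p d d<p with coprime-Bézout (prime⇒coprime pr d<p)
  ... | Bézout.+- x y eq = Z.- + y , (Z.- + x , (begin
        + d Z.* Z.- + y Z.- + 1    ≡⟨ rearrange (+ d) (+ y) ⟩
        Z.- (+ 1 Z.+ + y Z.* + d)  ≡⟨ cong Z.-_ (trans (cong (λ w → + 1 Z.+ w) (sym (ZP.pos-* y d))) (cong +_ eq)) ⟩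
        Z.- + (x N.* p)            ≡⟨ cong Z.-_ (ZP.pos-* x p) ⟩
        Z.- (+ x Z.* + p)          ≡⟨ ZP.neg-distribˡ-* (+ x) (+ p) ⟩
        Z.- + x Z.* + p            ∎))
    where
    open ≡-Reasoning
    rearrange : ∀ d y → d Z.* Z.- y Z.- + 1 ≡ Z.- (+ 1 Z.+ y Z.* d)
    rearrange = solve-∀
  ... | Bézout.-+ x y eq = + y , (+ x , (begin
        + d Z.* + y Z.- + 1             ≡⟨ cong (Z._- + 1) (trans (ZP.*-comm (+ d) (+ y)) (sym (ZP.pos-* y d))) ⟩
        + (y N.* d) Z.- + 1             ≡⟨ cong (λ w → + w Z.- + 1) (sym eq) ⟩
        + (1 N.+ x N.* p) Z.- + 1       ≡⟨ cong (λ w → (+ 1 Z.+ w) Z.- + 1) (ZP.pos-* x p) ⟩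
        (+ 1 Z.+ + x Z.* + p) Z.- + 1   ≡⟨ cancel (+ x) (+ p) ⟩
        + x Z.* + p                     ∎))
    where
    open ≡-Reasoning
    cancel : ∀ x p → (+ 1 Z.+ x Z.* p) Z.- + 1 ≡ x Z.* p
    cancel = solve-∀

  -- Newton step: an inverse of t modulo p^(m+1) is improved to one
  -- modulo p^(m+2), since t y' - 1 = -(t y - 1)².
  newton-step : ∀ m t y → t Z.* y ≡ + 1 [mod p N.^ suc m ] →
                t Z.* (y Z.* (+ 2 Z.- t Z.* y)) ≡ + 1 [mod p N.^ suc (suc m) ]
  newton-step m t y (k , e) = Z.- (k Z.* k Z.* + (p N.^ m)) , (begin
      t Z.* (y Z.* (+ 2 Z.- t Z.* y)) Z.- + 1
        ≡⟨ square t y ⟩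
      Z.- ((t Z.* y Z.- + 1) Z.* (t Z.* y Z.- + 1))
        ≡⟨ cong (λ w → Z.- (w Z.* w)) (trans e (cong (k Z.*_) (ZP.pos-* p (p N.^ m)))) ⟩
      Z.- ((k Z.* (+ p Z.* + (p N.^ m))) Z.* (k Z.* (+ p Z.* + (p N.^ m))))
        ≡⟨ regroup k (+ p) (+ (p N.^ m)) ⟩
      Z.- (k Z.* k Z.* + (p N.^ m)) Z.* (+ p Z.* (+ p Z.* + (p N.^ m)))
        ≡⟨ cong (λ w → Z.- (k Z.* k Z.* + (p N.^ m)) Z.* w)
                (sym (trans (ZP.pos-* p (p N.* p N.^ m)) (cong (+ p Z.*_) (ZP.pos-* p (p N.^ m))))) ⟩
      Z.- (k Z.* k Z.* + (p N.^ m)) Z.* + (p N.^ suc (suc m)) ∎)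
    where
    open ≡-Reasoning
    square : ∀ t y → t Z.* (y Z.* (+ 2 Z.- t Z.* y)) Z.- + 1 ≡ Z.- ((t Z.* y Z.- + 1) Z.* (t Z.* y Z.- + 1))
    square = solve-∀
    regroup : ∀ k p q → Z.- ((k Z.* (p Z.* q)) Z.* (k Z.* (p Z.* q))) ≡ Z.- (k Z.* k Z.* q) Z.* (p Z.* (p Z.* q))
    regroup = solve-∀

  module Inverse (u : Zp) (u₀≢0 : toℕ (u 0) ≢ 0) where

    instance
      u₀-nonZero : NonZero (toℕ (u 0))
      u₀-nonZero = N.≢-nonZero u₀≢0

    Y : ℕ → ℤ
    Y zero          = + 0
    Y (suc zero)    = proj₁ (inverse-mod-p (toℕ (u 0)) (FP.toℕ<n (u 0)))
    Y (suc (suc m)) = Y (suc m) Z.* (+ 2 Z.- ⟦ u ⟧ (suc (suc m)) Z.* Y (suc m))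

    Y-inverse : ∀ m → ⟦ u ⟧ m Z.* Y m ≡ + 1 [mod p N.^ m ]
    Y-inverse zero          = Z.0ℤ Z.- + 1 , sym (ZP.*-identityʳ _)
    Y-inverse (suc zero)    =
      subst (λ q → ⟦ u ⟧ 1 Z.* Y 1 ≡ + 1 [mod q ]) (sym (NP.*-identityʳ p))
        (subst (λ w → + w Z.* Y 1 ≡ + 1 [mod p ]) (sym (NP.*-identityʳ (toℕ (u 0))))
          (proj₂ (inverse-mod-p (toℕ (u 0)) (FP.toℕ<n (u 0)))))
    Y-inverse (suc (suc m)) = newton-step m (⟦ u ⟧ (suc (suc m))) (Y (suc m))
      (mod-trans (mod-sym (mod-* (tr-step u (suc m)) (mod-refl {a = Y (suc m)}))) (Y-inverse (suc m)))

    -- Y m ≡ Y m · u · Y (m+1) ≡ Y (m+1) mod p^m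
    Y-compatible : ∀ m → Y m ≡ Y (suc m) [mod p N.^ m ]
    Y-compatible m =
      mod-trans (mod-≡ (sym (ZP.*-identityʳ (Y m))))
      (mod-trans (mod-* (mod-refl {a = Y m}) (mod-sym (mod-weaken₁ {m = m} (Y-inverse (suc m)))))
      (mod-trans (mod-≡ (reassociate (Y m) (⟦ u ⟧ (suc m)) (Y (suc m))))
      (mod-trans (mod-* (mod-* (mod-sym (tr-step u m)) (mod-refl {a = Y m})) (mod-refl {a = Y (suc m)}))
      (mod-trans (mod-* (Y-inverse m) (mod-refl {a = Y (suc m)})) (mod-≡ (ZP.*-identityˡ (Y (suc m))))))))
      where
      reassociate : ∀ a b c → a Z.* (b Z.* c) ≡ (b Z.* a) Z.* c
      reassociate = solve-∀

    private
      module L = Limit (λ m → (Y m %ℕ p N.^ m) {{p^≢0 m}})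
                       (λ m → mod-trans (%ℕ-mod (Y m) m)
                                (mod-trans (Y-compatible m) (mod-sym (mod-weaken₁ {m = m} (%ℕ-mod (Y (suc m)) (suc m))))))

    u⁻¹ : Zp
    u⁻¹ = L.limit

    u⁻¹-inverse : ∀ N → ⟦ u ⟧ N Z.* ⟦ u⁻¹ ⟧ N ≡ + 1 [mod p N.^ N ]
    u⁻¹-inverse N = mod-trans (mod-* (mod-refl {a = ⟦ u ⟧ N}) (mod-trans (L.limit-mod N) (%ℕ-mod (Y N) N)))
                      (Y-inverse N)

  shift : Zp → ℕ → Zp
  shift x j n = x (n N.+ j)

  LeadingZeros : Zp → ℕ → Set
  LeadingZeros x j = ∀ i → i < j → toℕ (x i) ≡ 0

  tr-zeros : ∀ x j → LeadingZeros x j → tr x j ≡ 0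
  tr-zeros x zero    zs = refl
  tr-zeros x (suc j) zs rewrite tr-zeros x j (λ i i<j → zs i (NP.m<n⇒m<1+n i<j)) | zs j (NP.n<1+n j) = refl

  tr-shift : ∀ x j → LeadingZeros x j → ∀ m → tr x (m N.+ j) ≡ p N.^ j N.* tr (shift x j) m
  tr-shift x j zs zero    = trans (tr-zeros x j zs) (sym (NP.*-zeroʳ (p N.^ j)))
  tr-shift x j zs (suc m) = begin
      tr x (m N.+ j) N.+ toℕ (x (m N.+ j)) N.* p N.^ (m N.+ j)
        ≡⟨ cong₂ (λ u v → u N.+ toℕ (x (m N.+ j)) N.* v) (tr-shift x j zs m) (NP.^-distribˡ-+-* p m j) ⟩
      p N.^ j N.* tr (shift x j) m N.+ toℕ (x (m N.+ j)) N.* (p N.^ m N.* p N.^ j)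
        ≡⟨ factor (p N.^ j) (tr (shift x j) m) (toℕ (x (m N.+ j))) (p N.^ m) ⟩
      p N.^ j N.* (tr (shift x j) m N.+ toℕ (x (m N.+ j)) N.* p N.^ m) ∎
    where
    open ≡-Reasoning
    factor : ∀ a b c e → a N.* b N.+ c N.* (e N.* a) ≡ a N.* (b N.+ c N.* e)
    factor = NS.solve-∀

  tr≡0⇒zeros : ∀ x n → tr x n ≡ 0 → LeadingZeros x n
  tr≡0⇒zeros x (suc n) e i i<1+n with NP.m≤n⇒m<n∨m≡n (N.s≤s⁻¹ i<1+n)
  ... | inj₁ i<n = tr≡0⇒zeros x n (NP.m+n≡0⇒m≡0 (tr x n) e) i i<n
  ... | inj₂ refl = NP.m*n≡0⇒m≡0 (toℕ (x i)) (p N.^ i) {{p^≢0 i}} (NP.m+n≡0⇒n≡0 (tr x n) e)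

  first-nonzero-digit : ∀ x n → tr x n ≢ 0 → Σ ℕ λ j → (toℕ (x j) ≢ 0) × LeadingZeros x j
  first-nonzero-digit x zero    tr≢0 = ⊥-elim (tr≢0 refl)
  first-nonzero-digit x (suc n) tr≢0 with tr x n N.≟ 0
  ... | no tr≢0′ = first-nonzero-digit x n tr≢0′
  ... | yes tr≡0 = n , (λ xₙ≡0 → tr≢0 (cong₂ (λ u v → u N.+ v N.* p N.^ n) tr≡0 xₙ≡0)) , tr≡0⇒zeros x n tr≡0

  -- (p^j u) / p^k has inverse (u⁻¹ / p^j) · p^k
  nonzero-digit⇒unit : ∀ e j → toℕ (proj₁ e j) ≢ 0 → LeadingZeros (proj₁ e) j → Unit e
  nonzero-digit⇒unit e j nz zs =
    (I.u⁻¹ , j) *Q intQ (P^ k) ,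
    ⟨ ≈Q-intro (val e ⊗ (val (I.u⁻¹ , j) ⊗ int (P^ k))) (int (+ 1)) (λ N →
        mod-combination₂ (⟦ I.u⁻¹ ⟧ N Z.* P^ k) (P^ j Z.* P^ k)
          (identity (⟦ proj₁ e ⟧ N) (⟦ I.u⁻¹ ⟧ N) (⟦ u ⟧ N) (P^ k) (P^ j))
          (e≡p^ju N) (I.u⁻¹-inverse N)) ⟩
    where
    k = proj₂ e
    u = shift (proj₁ e) j
    module I = Inverse u nz
    e≡p^ju : ∀ N → ⟦ proj₁ e ⟧ N ≡ P^ j Z.* ⟦ u ⟧ N [mod p N.^ N ]
    e≡p^ju N = mod-trans (tr-level (proj₁ e) (NP.m≤m+n N j))
                 (mod-≡ (trans (cong +_ (tr-shift (proj₁ e) j zs N)) (ZP.pos-* (p N.^ j) (tr u N))))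
    identity : ∀ x y u pk pj → (x Z.* (y Z.* pk)) Z.* + 1 Z.- + 1 Z.* (pk Z.* (pj Z.* + 1))
               ≡ (y Z.* pk) Z.* (x Z.- pj Z.* u) Z.+ (pj Z.* pk) Z.* (u Z.* y Z.- + 1)
    identity = solve-∀

  nonzero-tr⇒unit : ∀ e n → tr (proj₁ e) n ≢ 0 → Unit e
  nonzero-tr⇒unit e n tr≢0 with first-nonzero-digit (proj₁ e) n tr≢0
  ... | j , nz , zs = nonzero-digit⇒unit e j nz zs

  p^E≢0 : ∀ E → ¬ (+ 0 ≡ + 1 Z.* P^ E [mod p N.^ suc E ])
  p^E≢0 E (t , e) = p≢1 (NP.m*n≡1⇒n≡1 (Z.∣ t ∣) p (trans (sym (ZP.abs-* t (+ p))) (cong Z.∣_∣ (sym -1≡tp))))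
    where
    p≢1 : p ≢ 1
    p≢1 = N.nonTrivial⇒≢1 {{prime⇒nonTrivial pr}}
    scaled : P^ E Z.* Z.- + 1 ≡ P^ E Z.* (t Z.* + p)
    scaled = begin
        P^ E Z.* Z.- + 1             ≡⟨ negate (P^ E) ⟩
        + 0 Z.- + 1 Z.* P^ E         ≡⟨ e ⟩
        t Z.* + (p N.* p N.^ E)      ≡⟨ cong (t Z.*_) (ZP.pos-* p (p N.^ E)) ⟩
        t Z.* (+ p Z.* P^ E)         ≡⟨ swap t (+ p) (P^ E) ⟩
        P^ E Z.* (t Z.* + p)         ∎
      where
      open ≡-Reasoning
      negate : ∀ a → a Z.* Z.- + 1 ≡ + 0 Z.- + 1 Z.* a
      negate = solve-∀
      swap : ∀ t p a → t Z.* (p Z.* a) ≡ a Z.* (t Z.* p)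
      swap = solve-∀
    -1≡tp : Z.- + 1 ≡ t Z.* + p
    -1≡tp = ZP.*-cancelˡ-≡ (P^ E) _ _ {{p^≢0 E}} scaled

  -- Some entry of a matrix with determinant one is a unit: otherwise all
  -- four numerators vanish mod p^(E+1), where p^E is the denominator of
  -- ad - bc, and then ad - bc ≈ 1 would give p^(E+1) ∣ p^E.
  unit-entry : ∀ (a b c d : Q) → (a *Q d) +Q (-Q (b *Q c)) ≈Q 1Q → Unit a ⊎ Unit b ⊎ Unit c ⊎ Unit d
  unit-entry a b c d det = decide (small? a) (small? b) (small? c) (small? d)
    where
    det-expr = val a ⊗ val d ⊕ ⊖ (val b ⊗ val c)
    E = proj₂ ⟪ det-expr ⟫
    n = suc E
    Small : Q → Set
    Small x = tr (proj₁ x) n ≡ 0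
    small? : ∀ x → Dec (Small x)
    small? x = tr (proj₁ x) n N.≟ 0
    decide : Dec (Small a) → Dec (Small b) → Dec (Small c) → Dec (Small d) → Unit a ⊎ Unit b ⊎ Unit c ⊎ Unit d
    decide (no a≢0) _ _ _                = inj₁ (nonzero-tr⇒unit a n a≢0)
    decide (yes _) (no b≢0) _ _          = inj₂ (inj₁ (nonzero-tr⇒unit b n b≢0))
    decide (yes _) (yes _) (no c≢0) _    = inj₂ (inj₂ (inj₁ (nonzero-tr⇒unit c n c≢0)))
    decide (yes _) (yes _) (yes _) (no d≢0) = inj₂ (inj₂ (inj₂ (nonzero-tr⇒unit d n d≢0)))
    decide (yes a≡0) (yes b≡0) (yes c≡0) (yes d≡0) =
      ⊥-elim (p^E≢0 E (subst₂ (λ u v → u ≡ v [mod p N.^ n ]) num≡0 den≡p^E (≈Q-elim det-expr (int (+ 1)) det n)))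
      where
      vanish : ∀ xa xb xc xd pa pb pc pd → xa ≡ + 0 → xb ≡ + 0 → xc ≡ + 0 → xd ≡ + 0 →
               ((xa Z.* xd) Z.* (pb Z.* pc) Z.+ Z.- (xb Z.* xc) Z.* (pa Z.* pd)) Z.* + 1 ≡ + 0
      vanish _ _ _ _ pa pb pc pd refl refl refl refl = zero-identity pa pb pc pd
        where
        zero-identity : ∀ pa pb pc pd → ((+ 0 Z.* + 0) Z.* (pb Z.* pc) Z.+ Z.- (+ 0 Z.* + 0) Z.* (pa Z.* pd)) Z.* + 1 ≡ + 0
        zero-identity = solve-∀
      num≡0 : num det-expr n Z.* + 1 ≡ + 0
      num≡0 = vanish _ _ _ _ (D a) (D b) (D c) (D d) (cong +_ a≡0) (cong +_ b≡0) (cong +_ c≡0) (cong +_ d≡0)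
      den≡p^E : + 1 Z.* den det-expr ≡ + 1 Z.* P^ E
      den≡p^E = cong (+ 1 Z.*_) (sym (den-correct det-expr))

module Cocycle (p : ℕ) (pr : Prime p) (L : FiniteExtension p pr) (V : TorsionSL2Rep p pr L)
               (v : TorsionSL2Rep.M V) (v-invariant-mod-M^G : TorsionSL2Rep.ClassInvariantInQuotient V v) where

  import Defs
  open Defs using (SL2; mat)
  open import Data.Nat as N using ()
  open import Data.Product using (_,_; proj₁; proj₂)
  open import Algebra.Bundles using (AbelianGroup)
  import Relation.Binary.PropositionalEquality as ≡

  open TorsionSL2Rep V hiding (_·_)
  open Rationals p pr using (ℚp-ring; ℤ→ℚp; ⟨_⟩; un; p^-divisible)
  open SpecialLinearGroup ℚp-ring ℤ→ℚp public

  M-group : AbelianGroup 0ℓ 0ℓ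
  M-group = record { isAbelianGroup = isAbelianGroup }

  open AbelianGroup M-group public using (setoid; ∙-cong; assoc; comm; inverseˡ; identityʳ; identityˡ)
    renaming (refl to ≈-refl; sym to ≈-sym; trans to ≈-trans)

  toSL2 : SL → SL2 p pr
  toSL2 g = mat (a g) (b g) (c g) (d g) (un (det g))

  fromSL2 : SL2 p pr → SL
  fromSL2 g = mk (Defs.a g) (Defs.b g) (Defs.c g) (Defs.d g) ⟨ Defs.det≡1 g ⟩

  ≈SL2-refl : ∀ g → Defs._≈SL2_ p pr g g
  ≈SL2-refl g = (λ n → ≡.refl) , (λ n → ≡.refl) , (λ n → ≡.refl) , (λ n → ≡.refl)

  φ : SL → M
  φ g = ρ (toSL2 g) v -M v

  φ-cong : ∀ {g h} → g ≃ h → φ g ≈ φ h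
  φ-cong (ea , eb , ec , ed) = ∙-cong (ρ-cong (un ea , un eb , un ec , un ed) ≈-refl) ≈-refl

  action : ∀ g → ρ (toSL2 g) v ≈ (φ g + v)
  action g = ≈-sym (≈-trans (assoc _ _ _) (≈-trans (∙-cong ≈-refl (inverseˡ v)) (identityʳ _)))

  -- φ is a homomorphism, because φ h is G-invariant:
  -- gh v - v = g (φ h + v) - v = φ h + (g v - v).
  φ-· : ∀ g h → φ (g · h) ≈ (φ g + φ h)
  φ-· g h = begin
      ρ (toSL2 (g · h)) v -M v
        ≈⟨ ∙-cong (ρ-product (toSL2 g) (toSL2 h) (toSL2 (g · h)) v product) ≈-refl ⟩
      ρ (toSL2 g) (ρ (toSL2 h) v) -M v
        ≈⟨ ∙-cong (ρ-cong (≈SL2-refl (toSL2 g)) (action h)) ≈-refl ⟩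
      ρ (toSL2 g) (φ h + v) -M v
        ≈⟨ ∙-cong (ρ-+ (toSL2 g) (φ h) v) ≈-refl ⟩
      (ρ (toSL2 g) (φ h) + ρ (toSL2 g) v) -M v
        ≈⟨ ∙-cong (∙-cong (v-invariant-mod-M^G (toSL2 h) (toSL2 g)) ≈-refl) ≈-refl ⟩
      (φ h + ρ (toSL2 g) v) -M v
        ≈⟨ assoc _ _ _ ⟩
      φ h + φ g
        ≈⟨ comm _ _ ⟩
      φ g + φ h ∎
    where
    open SetoidReasoning setoid
    product : Defs.IsProduct p pr (toSL2 g) (toSL2 h) (toSL2 (g · h))
    product = (λ n → ≡.refl) , (λ n → ≡.refl) , (λ n → ≡.refl) , (λ n → ≡.refl)

  open Homomorphism M-group φ φ-cong φ-· public

  -- φ vanishes on u x and l x: M is killed by p^K, and every x ∈ ℚ_p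
  -- is p^K · (x / p^K).
  K : ℕ
  K = proj₁ killedByPowerOfp

  φ-kills-u : ∀ x → φ (u x) ≈ 0M
  φ-kills-u x = OneParameter.kills-divisible u u-cong u-+ (p N.^ K) (proj₂ killedByPowerOfp) x _ (p^-divisible K x)

  φ-kills-l : ∀ x → φ (l x) ≈ 0M
  φ-kills-l x = OneParameter.kills-divisible l l-cong l-+ (p N.^ K) (proj₂ killedByPowerOfp) x _ (p^-divisible K x)

  elementary : ∀ g → Elementary (fromSL2 g)
  elementary g = unit-entry⇒elementary (fromSL2 g) (Units.unit-entry p pr _ _ _ _ (Defs.det≡1 g))

mainTheorem18 : (p : ℕ) (pr : Prime p) (L : FiniteExtension p pr)
                (V : TorsionSL2Rep p pr L) (v : TorsionSL2Rep.M V) →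
                TorsionSL2Rep.ClassInvariantInQuotient V v →
                TorsionSL2Rep.ClassZeroInQuotient V v
mainTheorem18 p pr L V v v-invariant-mod-M^G g = begin
    ρ g v                ≈⟨ action (fromSL2 g) ⟩
    φ (fromSL2 g) + v    ≈⟨ ∙-cong (kills-elementary φ-kills-u φ-kills-l (elementary g)) ≈-refl ⟩
    0M + v               ≈⟨ identityˡ v ⟩
    v                    ∎
  where
  open Cocycle p pr L V v v-invariant-mod-M^G
  open TorsionSL2Rep V using (ρ; _+_; 0M)
  open SetoidReasoning setoid
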